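{- For any $f\colon\{0,1\}^n\to\{0,1\}$ it holds that $\frac{K(f)}{4}\le K_\infty(f)\le K(f)$.
   Context: For $A\subseteq f^{ -1}(1)$, $B\subseteq f^{ -1}(0)$, let $E(A,B)$ be the set of pairs $(a,b)\in A\times B$ that differ in exactly one coordinate. The Khrapchenko bound is $K(f)=\max_{A\subseteq f^{ -1}(1),B\subseteq f^{ -1}(0)}\frac{|E(A,B)|^2}{|A|\cdot|B|}$ (over nonempty $A,B$). For a finite alphabet $\Sigma$ and $f\colon\Sigma^n\to\{0,1\}$, a Khrapchenko distribution for $f$ is a distribution $(\mathbf{a},\mathbf{b})$ on $f^{ -1}(1)\times f^{ -1}(0)$ such that $\mathbf{a},\mathbf{b}$ always differ in exactly one coordinate, denoted $\mathbf{i}\in[n]$. The conditional min-entropy is $H_\infty(\mathbf{x}\mid\mathbf{y})=\min_{x,y}\log\frac{1}{\Pr[\mathbf{x}=x\mid\mathbf{y}=y]}$ (base-2 log, over $x,y$ in the supports). The min-entropy Khrapchenko bound $K_\infty(f)$ is the maximum of $2^{H_\infty(\mathbf{i}\mid\mathbf{a})+H_\infty(\mathbf{i}\mid\mathbf{b})}$ over all Khrapchenko distributions $(\mathbf{a},\mathbf{b})$ for $f$. Here $\Sigma=\{0,1\}$.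
   Formalization: Khrapchenko distributions $(\mathbf{a},\mathbf{b})$ take only rational probabilities. -}

module Defs where

open import Data.Bool using (Bool; true; false; not; if_then_else_)
open import Data.Nat as ℕ using (ℕ; zero; suc)
open import Data.Fin using (Fin)
open import Data.Vec using (Vec; []; _∷_; lookup; updateAt)
open import Data.List using (List; []; _∷_; map; concatMap; foldr; length; filter)
open import Data.Nat.ListAction using (sum)
open import Data.Integer using (+_)
open import Data.List.Base using (allFin)
open import Data.Rational as ℚ using (ℚ; 0ℚ; 1ℚ; _≤_; _<_; _*_; _÷_; _⊔_)
open import Data.Rational.Properties using (_≟_)
open import Relation.Nullary using (yes; no)
open import Relation.Nullary.Decidable using (⌊_⌋)
open import Relation.Binary.PropositionalEquality using (_≡_)
open import Data.Product using (Σ; _×_; _,_)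

allVecs : (n : ℕ) → List (Vec Bool n)
allVecs zero    = [] ∷ []
allVecs (suc n) = concatMap (λ v → (false ∷ v) ∷ (true ∷ v) ∷ []) (allVecs n)

hamming : ∀ {n} → Vec Bool n → Vec Bool n → ℕ
hamming []       []       = 0
hamming (x ∷ xs) (y ∷ ys) = (if x Data.Bool.xor y then 1 else 0) ℕ.+ hamming xs ys

flipAt : ∀ {n} → Vec Bool n → Fin n → Vec Bool n
flipAt v i = updateAt v i not

count : ∀ {n} → (Vec Bool n → Bool) → ℕ
count {n} P = length (filter (λ x → Data.Bool.T? (P x)) (allVecs n))

fromℕℚ : ℕ → ℚ
fromℕℚ m = (+ m) ℚ./ 1

sumℚ : ∀ {A : Set} → List A → (A → ℚ) → ℚ
sumℚ xs g = foldr (λ x acc → g x ℚ.+ acc) 0ℚ xs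

maxℚ : ∀ {A : Set} → List A → (A → ℚ) → ℚ
maxℚ xs g = foldr (λ x acc → g x ⊔ acc) 0ℚ xs

-- division, returning 0 on a zero denominator (only used where the
-- denominator is positive, or where the corresponding term is irrelevant)
safeDiv : ℚ → ℚ → ℚ
safeDiv p q with q ≟ 0ℚ
... | yes _  = 0ℚ
... | no q≢0 = _÷_ p q {{ℚ.≢-nonZero q≢0}}

-- subsets A ⊆ {0,1}^n are represented by their indicator functions

edges : ∀ {n} → (Vec Bool n → Bool) → (Vec Bool n → Bool) → ℕ
edges {n} A B =
  sum (map (λ a → sum (map (λ b →
    if A a Data.Bool.∧ B b Data.Bool.∧ ⌊ hamming a b ℕ.≟ 1 ⌋ then 1 else 0)
    (allVecs n))) (allVecs n))

ratio : ∀ {n} → (Vec Bool n → Bool) → (Vec Bool n → Bool) → ℚ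
ratio A B = safeDiv (fromℕℚ (edges A B ℕ.* edges A B))
                    (fromℕℚ (count A ℕ.* count B))

Admissible : ∀ {n} → (Vec Bool n → Bool) →
             (Vec Bool n → Bool) → (Vec Bool n → Bool) → Set
Admissible f A B =
  (∀ x → A x ≡ true → f x ≡ true) × (∀ x → B x ≡ true → f x ≡ false) ×
  (0 ℕ.< count A) × (0 ℕ.< count B)

IsKhrapchenkoBound : ∀ {n} → (Vec Bool n → Bool) → ℚ → Set
IsKhrapchenkoBound f k =
  (Σ _ λ A → Σ _ λ B → Admissible f A B × ratio A B ≡ k) ×
  (∀ A B → Admissible f A B → ratio A B ≤ k)

record KhrapchenkoDist {n : ℕ} (f : Vec Bool n → Bool) : Set where
  field
    μ        : Vec Bool n → Vec Bool n → ℚ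
    nonneg   : ∀ a b → 0ℚ ≤ μ a b
    total    : sumℚ (allVecs n) (λ a → sumℚ (allVecs n) (λ b → μ a b)) ≡ 1ℚ
    support  : ∀ a b → 0ℚ < μ a b →
               (f a ≡ true) × (f b ≡ false) × (hamming a b ≡ 1)

module _ {n : ℕ} {f : Vec Bool n → Bool} (D : KhrapchenkoDist f) where
  open KhrapchenkoDist D

  margA : Vec Bool n → ℚ
  margA a = sumℚ (allVecs n) (λ b → μ a b)

  margB : Vec Bool n → ℚ
  margB b = sumℚ (allVecs n) (λ a → μ a b)

  -- Pr[𝐢 = i | 𝐚 = a]: the unique b differing from a exactly at i is flipAt a i
  condA : Vec Bool n → Fin n → ℚ
  condA a i = safeDiv (μ a (flipAt a i)) (margA a)

  condB : Vec Bool n → Fin n → ℚ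
  condB b i = safeDiv (μ (flipAt b i) b) (margB b)

  -- 2^{-H∞(𝐢|𝐚)} = max_{a,i} Pr[𝐢 = i | 𝐚 = a]  (over a in the support)
  maxCondA : ℚ
  maxCondA = maxℚ (allVecs n) (λ a → maxℚ (allFin n) (λ i → condA a i))

  maxCondB : ℚ
  maxCondB = maxℚ (allVecs n) (λ b → maxℚ (allFin n) (λ i → condB b i))

  -- 2^{H∞(𝐢|𝐚) + H∞(𝐢|𝐛)}
  minEntropyValue : ℚ
  minEntropyValue = safeDiv 1ℚ (maxCondA * maxCondB)

{-# OPTIONS --safe #-}
-- Write p𝐚 = max Pr[𝐢 = i | 𝐚 = a] and p𝐛 likewise, so that K∞ = 1 / (p𝐚 p𝐛).
--
-- Let A and B be the supports of 𝐚 and 𝐛. For a ∈ A every b with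
-- Pr[𝐚 = a, 𝐛 = b] > 0 is a neighbour of a in B, and each such term is at most
-- p𝐚 Pr[𝐚 = a]; summing over b gives deg a ≥ 1 / p𝐚, so |A| ≤ p𝐚 |E(A,B)|.
-- Likewise |B| ≤ p𝐛 |E(A,B)|, hence 1 / (p𝐚 p𝐛) ≤ |E(A,B)|² / (|A| |B|) ≤ K.
--
-- Let (A, B) attain K. Removing a vertex a from A cannot increase
-- the ratio, which forces deg a ≥ |E(A,B)| / (2 |A|); similarly for B. Under
-- the uniform distribution on E(A,B), Pr[𝐢 = i | 𝐚 = a] ≤ 1 / deg a
-- ≤ 2 |A| / |E(A,B)|, so K∞ ≥ |E(A,B)|² / (4 |A| |B|) = K / 4.
module Submission where

open import Defs
open import Data.Bool.Base using (Bool; true; false; not; _∧_; if_then_else_)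
open import Data.Bool.Properties using (T?)
open import Data.Empty using (⊥-elim)
open import Data.Fin.Base using (Fin)
import Data.Fin.Base as Fin
open import Data.List.Base using ([]; _∷_; map; concatMap; filter; length; allFin)
open import Data.List.Membership.Propositional using (_∈_)
open import Data.List.Membership.Propositional.Properties using (∈-allFin)
open import Data.List.Relation.Unary.Any using (here; there)
import Data.List.Properties as List
open import Data.Nat.Base as ℕ using (ℕ; zero; suc; z≤n; s≤s)
import Data.Nat.Properties as ℕ
open import Data.Nat.ListAction using (sum)
open import Data.Product.Base using (Σ; ∃-syntax; _×_; _,_; proj₁; proj₂)
open import Data.Vec.Base using (Vec; []; _∷_)
open import Function.Base using (flip; _∘_)
open import Relation.Binary.PropositionalEquality
open import Relation.Nullary using (Dec; yes; no)
open import Relation.Nullary.Decidable using (⌊_⌋)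

𝟙 : Bool → ℕ
𝟙 b = if b then 1 else 0

∑ : ∀ {n} → (Vec Bool n → ℕ) → ℕ
∑ {n} g = sum (map g (allVecs n))

private
  variable
    X Y : Set

-- Sums over lists and over the hypercube

module _ where
  open import Data.Nat.Base using (_+_; _≤_; _<_)
  open import Algebra.Properties.CommutativeSemigroup ℕ.+-commutativeSemigroup
    using () renaming (interchange to +-interchange)

  sum-map-+ : ∀ (g h : X → ℕ) xs →
              sum (map (λ x → g x + h x) xs) ≡ sum (map g xs) + sum (map h xs)
  sum-map-+ g h []       = refl
  sum-map-+ g h (x ∷ xs) = trans (cong (g x + h x +_) (sum-map-+ g h xs))
                                 (+-interchange (g x) (h x) _ _)

  sum-map-zero : ∀ (g : X → ℕ) xs → (∀ x → g x ≡ 0) → sum (map g xs) ≡ 0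
  sum-map-zero g []       g≡0 = refl
  sum-map-zero g (x ∷ xs) g≡0 = cong₂ _+_ (g≡0 x) (sum-map-zero g xs g≡0)

  sum-map-swap : ∀ (g : X → Y → ℕ) xs ys →
                 sum (map (λ x → sum (map (g x) ys)) xs) ≡
                 sum (map (λ y → sum (map (flip g y) xs)) ys)
  sum-map-swap g []       ys = sym (sum-map-zero _ ys (λ _ → refl))
  sum-map-swap g (x ∷ xs) ys = trans (cong (sum (map (g x) ys) +_) (sum-map-swap g xs ys))
                                     (sym (sum-map-+ (g x) _ ys))

  ∈⇒≤sum-map : ∀ (g : X → ℕ) {x xs} → x ∈ xs → g x ≤ sum (map g xs)
  ∈⇒≤sum-map g {xs = y ∷ xs} (here refl)  = ℕ.m≤m+n (g y) _
  ∈⇒≤sum-map g {xs = y ∷ xs} (there x∈xs) = ℕ.≤-trans (∈⇒≤sum-map g x∈xs) (ℕ.m≤n+m _ (g y))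

  0<sum-map⇒∃ : ∀ (g : X → ℕ) xs → 0 < sum (map g xs) → ∃[ x ] 0 < g x
  0<sum-map⇒∃ g []       ()
  0<sum-map⇒∃ g (x ∷ xs) 0<Σ with g x in gx
  ... | zero  = 0<sum-map⇒∃ g xs 0<Σ
  ... | suc _ = x , subst (0 <_) (sym gx) (s≤s z≤n)

module _ where
  open import Data.Nat.Base using (_+_)
  open import Data.Bool.Properties using (not-¬)
  open import Data.Vec.Properties using (∷-injectiveˡ; ∷-injectiveʳ)
  open import Algebra.Properties.CommutativeSemigroup ℕ.+-commutativeSemigroup
    using () renaming (interchange to +-interchange)

  ∈-allVecs : ∀ {n} (v : Vec Bool n) → v ∈ allVecs n
  ∈-allVecs []      = here refl
  ∈-allVecs (b ∷ v) = ∈-concatMap b (∈-allVecs v)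
    where
    ∈-concatMap : ∀ {n} b {v : Vec Bool n} {vs} → v ∈ vs →
                  (b ∷ v) ∈ concatMap (λ v → (false ∷ v) ∷ (true ∷ v) ∷ []) vs
    ∈-concatMap false (here refl)  = here refl
    ∈-concatMap true  (here refl)  = there (here refl)
    ∈-concatMap b     (there v∈vs) = there (there (∈-concatMap b v∈vs))

  ∑-split : ∀ {n} (g : Vec Bool (suc n) → ℕ) →
            ∑ g ≡ ∑ (λ v → g (false ∷ v)) + ∑ (λ v → g (true ∷ v))
  ∑-split {n} g = go (allVecs n)
    where
    go : ∀ vs → sum (map g (concatMap (λ v → (false ∷ v) ∷ (true ∷ v) ∷ []) vs)) ≡
                sum (map (λ v → g (false ∷ v)) vs) + sum (map (λ v → g (true ∷ v)) vs)
    go []       = refl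
    go (v ∷ vs) = begin
      g₀ + (g₁ + sum (map g (concatMap _ vs))) ≡⟨ cong (λ s → g₀ + (g₁ + s)) (go vs) ⟩
      g₀ + (g₁ + (s₀ + s₁))                     ≡⟨ ℕ.+-assoc g₀ g₁ _ ⟨
      g₀ + g₁ + (s₀ + s₁)                       ≡⟨ +-interchange g₀ g₁ s₀ s₁ ⟩
      g₀ + s₀ + (g₁ + s₁)                       ∎
      where
      open ≡-Reasoning
      g₀ = g (false ∷ v)
      g₁ = g (true ∷ v)
      s₀ = sum (map (λ v → g (false ∷ v)) vs)
      s₁ = sum (map (λ v → g (true ∷ v)) vs)

  ∑-split-at : ∀ {n} b (g : Vec Bool (suc n) → ℕ) →
               ∑ g ≡ ∑ (λ v → g (b ∷ v)) + ∑ (λ v → g (not b ∷ v))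
  ∑-split-at false g = ∑-split g
  ∑-split-at true  g = trans (∑-split g) (ℕ.+-comm (∑ (λ v → g (false ∷ v))) _)

  ∑-cong : ∀ {n} {g h : Vec Bool n → ℕ} → (∀ v → g v ≡ h v) → ∑ g ≡ ∑ h
  ∑-cong {n} g≗h = cong sum (List.map-cong g≗h (allVecs n))

  ∑-extract : ∀ {n} (g h : Vec Bool n → ℕ) v →
              (∀ x → x ≢ v → g x ≡ h x) → h v ≡ 0 → ∑ g ≡ g v + ∑ h
  ∑-extract g h []      _   hv≡0 = cong (g [] +_) (sym (cong (_+ 0) hv≡0))
  ∑-extract g h (b ∷ v) g≗h hv≡0 = begin
    ∑ g                                                           ≡⟨ ∑-split-at b g ⟩
    ∑ (λ x → g (b ∷ x)) + ∑ (λ x → g (not b ∷ x))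
      ≡⟨ cong₂ _+_ (∑-extract (λ x → g (b ∷ x)) (λ x → h (b ∷ x)) v
                               (λ x x≢v → g≗h (b ∷ x) (x≢v ∘ ∷-injectiveʳ)) hv≡0)
                   (∑-cong (λ x → g≗h (not b ∷ x) (not-¬ refl ∘ sym ∘ ∷-injectiveˡ))) ⟩
    g (b ∷ v) + ∑ (λ x → h (b ∷ x)) + ∑ (λ x → h (not b ∷ x))
      ≡⟨ ℕ.+-assoc (g (b ∷ v)) _ _ ⟩
    g (b ∷ v) + (∑ (λ x → h (b ∷ x)) + ∑ (λ x → h (not b ∷ x)))
      ≡⟨ cong (g (b ∷ v) +_) (∑-split-at b h) ⟨
    g (b ∷ v) + ∑ h                                               ∎
    where open ≡-Reasoning

  count≡∑ : ∀ {n} (P : Vec Bool n → Bool) → count P ≡ ∑ (λ x → 𝟙 (P x))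
  count≡∑ {n} P = go (allVecs n)
    where
    go : ∀ xs → length (filter (λ x → T? (P x)) xs) ≡ sum (map (λ x → 𝟙 (P x)) xs)
    go []       = refl
    go (x ∷ xs) with P x
    ... | true  = cong suc (go xs)
    ... | false = go xs

module _ where
  open import Data.Bool.Properties using (xor-comm; xor-same)

  hamming-sym : ∀ {n} (a b : Vec Bool n) → hamming a b ≡ hamming b a
  hamming-sym []      []      = refl
  hamming-sym (x ∷ a) (y ∷ b) = cong₂ ℕ._+_ (cong 𝟙 (xor-comm x y)) (hamming-sym a b)

  hamming-refl : ∀ {n} (a : Vec Bool n) → hamming a a ≡ 0
  hamming-refl []      = refl
  hamming-refl (x ∷ a) = cong₂ ℕ._+_ (cong 𝟙 (xor-same x)) (hamming-refl a)

  hamming≡0⇒≡ : ∀ {n} {a b : Vec Bool n} → hamming a b ≡ 0 → a ≡ b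
  hamming≡0⇒≡ {a = []}        {[]}        _ = refl
  hamming≡0⇒≡ {a = false ∷ a} {false ∷ b} d = cong (false ∷_) (hamming≡0⇒≡ d)
  hamming≡0⇒≡ {a = true ∷ a}  {true ∷ b}  d = cong (true ∷_) (hamming≡0⇒≡ d)

  hamming≡1⇒flipAt : ∀ {n} (a b : Vec Bool n) → hamming a b ≡ 1 → ∃[ i ] b ≡ flipAt a i
  hamming≡1⇒flipAt []          []          ()
  hamming≡1⇒flipAt (false ∷ a) (false ∷ b) d with hamming≡1⇒flipAt a b d
  ... | i , b≡a[i] = Fin.suc i , cong (false ∷_) b≡a[i]
  hamming≡1⇒flipAt (true ∷ a)  (true ∷ b)  d with hamming≡1⇒flipAt a b d
  ... | i , b≡a[i] = Fin.suc i , cong (true ∷_) b≡a[i]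
  hamming≡1⇒flipAt (false ∷ a) (true ∷ b)  d =
    Fin.zero , cong (true ∷_) (sym (hamming≡0⇒≡ (ℕ.suc-injective d)))
  hamming≡1⇒flipAt (true ∷ a)  (false ∷ b) d =
    Fin.zero , cong (false ∷_) (sym (hamming≡0⇒≡ (ℕ.suc-injective d)))

  -- Walk from a to b one coordinate at a time; f changes value at some step.
  ∃-bichromatic-edge : ∀ {n} (f : Vec Bool n → Bool) {a b} → f a ≡ true → f b ≡ false →
    ∃[ a′ ] ∃[ b′ ] f a′ ≡ true × f b′ ≡ false × hamming a′ b′ ≡ 1
  ∃-bichromatic-edge f {[]} {[]} fa fb with () ← trans (sym fa) fb
  ∃-bichromatic-edge f {x ∷ a} {y ∷ b} fa fb with f (y ∷ a) in fya
  ... | true with ∃-bichromatic-edge (λ v → f (y ∷ v)) fya fb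
  ...   | a′ , b′ , fa′ , fb′ , d =
    y ∷ a′ , y ∷ b′ , fa′ , fb′ , cong₂ ℕ._+_ (cong 𝟙 (xor-same y)) d
  ∃-bichromatic-edge f {false ∷ a} {true ∷ b}  fa fb | false =
    false ∷ a , true ∷ a , fa , fya , cong suc (hamming-refl a)
  ∃-bichromatic-edge f {true ∷ a}  {false ∷ b} fa fb | false =
    true ∷ a , false ∷ a , fa , fya , cong suc (hamming-refl a)
  ∃-bichromatic-edge f {false ∷ a} {false ∷ b} fa fb | false with () ← trans (sym fa) fya
  ∃-bichromatic-edge f {true ∷ a}  {true ∷ b}  fa fb | false with () ← trans (sym fa) fya

module _ where
  open import Data.Nat.Base using (_+_; _*_; _≤_)
  open import Data.Nat.Tactic.RingSolver using (solve-∀)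

  -- With r = (2m+1)d + t + 1, r² exceeds d²m + 2drm by a polynomial with
  -- nonnegative coefficients.
  square-excess : ∀ d m t → let r = suc ((2 * m + 1) * d + t) in
    r * r ≡ d * d * m + 2 * d * r * m
            + suc (d * d * m + d * d + d * t + t * ((2 * m + 1) * d + t) + 2 * m * d + 2 * d + 2 * t)
  square-excess = solve-∀

  vertex-removal-bound : ∀ d r m → r * r * suc m ≤ (d + r) * (d + r) * m → d + r ≤ 2 * suc m * d
  vertex-removal-bound d r m H = subst (d + r ≤_) (regroup d m) (ℕ.+-monoʳ-≤ d r≤[2m+1]d)
    where
    regroup : ∀ d m → d + (2 * m + 1) * d ≡ 2 * suc m * d
    regroup = solve-∀

    expand₁ : ∀ r m → r * r * suc m ≡ r * r * m + r * r
    expand₁ = solve-∀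

    expand₂ : ∀ d r m → (d + r) * (d + r) * m ≡ r * r * m + (d * d * m + 2 * d * r * m)
    expand₂ = solve-∀

    r*r≤ : r * r ≤ d * d * m + 2 * d * r * m
    r*r≤ = ℕ.+-cancelˡ-≤ (r * r * m) _ _ (subst₂ _≤_ (expand₁ r m) (expand₂ d r m) H)

    r≤[2m+1]d : r ≤ (2 * m + 1) * d
    r≤[2m+1]d with r ℕ.≤? (2 * m + 1) * d
    ... | yes r≤ = r≤
    ... | no  r≰ with ℕ.m≤n⇒∃[o]m+o≡n (ℕ.≰⇒> r≰)
    ...   | t , refl = ⊥-elim (ℕ.m+1+n≰m bound (subst (_≤ bound) (square-excess d m t) r*r≤))
      where bound = d * d * m + 2 * d * r * m

-- Rationals

open import Data.Rational.Base as ℚ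
  using (ℚ; mkℚ; 0ℚ; 1ℚ; ½; _+_; _*_; _≤_; _<_; 1/_; *≤*; *<*)
import Data.Rational.Properties as ℚ
open import Data.Rational.Solver using (module +-*-Solver)
import Data.Rational.Unnormalised.Base as ℚᵘ
import Data.Rational.Unnormalised.Properties as ℚᵘ
import Data.Integer.Base as ℤ
import Data.Integer.Properties as ℤ
import Data.Nat.Coprimality as Coprime
open import Algebra.Bundles using (CommutativeMonoid)
open import Algebra.Properties.CommutativeSemigroup
  (CommutativeMonoid.commutativeSemigroup ℚ.*-1-commutativeMonoid)
  using () renaming (xy∙z≈xz∙y to *-rightComm; interchange to *-interchange)

private
  ⌜_⌝ : ℕ → ℚ
  ⌜ m ⌝ = mkℚ (ℤ.+ m) 0 (Coprime.sym (Coprime.1-coprimeTo m))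

  fromℕℚ≡⌜⌝ : ∀ m → fromℕℚ m ≡ ⌜ m ⌝
  fromℕℚ≡⌜⌝ m = ℚ.↥p/↧p≡p ⌜ m ⌝

fromℕℚ-+ : ∀ m n → fromℕℚ (m ℕ.+ n) ≡ fromℕℚ m + fromℕℚ n
fromℕℚ-+ m n rewrite fromℕℚ≡⌜⌝ m | fromℕℚ≡⌜⌝ n | fromℕℚ≡⌜⌝ (m ℕ.+ n) =
  ℚ.toℚᵘ-injective (ℚᵘ.≃-trans
    (ℚᵘ.*≡* (cong (ℤ._* ℤ.+ 1) (sym (cong₂ ℤ._+_ (ℤ.*-identityʳ (ℤ.+ m)) (ℤ.*-identityʳ (ℤ.+ n))))))
    (ℚᵘ.≃-sym (ℚ.toℚᵘ-homo-+ ⌜ m ⌝ ⌜ n ⌝)))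

fromℕℚ-* : ∀ m n → fromℕℚ (m ℕ.* n) ≡ fromℕℚ m * fromℕℚ n
fromℕℚ-* m n rewrite fromℕℚ≡⌜⌝ m | fromℕℚ≡⌜⌝ n | fromℕℚ≡⌜⌝ (m ℕ.* n) =
  ℚ.toℚᵘ-injective (ℚᵘ.≃-trans
    (ℚᵘ.*≡* (cong (ℤ._* ℤ.+ 1) (sym (ℤ.+◃n≡+n (m ℕ.* n)))))
    (ℚᵘ.≃-sym (ℚ.toℚᵘ-homo-* ⌜ m ⌝ ⌜ n ⌝)))

fromℕℚ-mono-≤ : ∀ {m n} → m ℕ.≤ n → fromℕℚ m ≤ fromℕℚ n
fromℕℚ-mono-≤ {m} {n} m≤n rewrite fromℕℚ≡⌜⌝ m | fromℕℚ≡⌜⌝ n =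
  *≤* (subst₂ ℤ._≤_ (sym (ℤ.*-identityʳ (ℤ.+ m))) (sym (ℤ.*-identityʳ (ℤ.+ n))) (ℤ.+≤+ m≤n))

fromℕℚ-cancel-≤ : ∀ {m n} → fromℕℚ m ≤ fromℕℚ n → m ℕ.≤ n
fromℕℚ-cancel-≤ {m} {n} le rewrite fromℕℚ≡⌜⌝ m | fromℕℚ≡⌜⌝ n with le
... | *≤* m≤n with subst₂ ℤ._≤_ (ℤ.*-identityʳ (ℤ.+ m)) (ℤ.*-identityʳ (ℤ.+ n)) m≤n
...   | ℤ.+≤+ m≤n′ = m≤n′

fromℕℚ-mono-< : ∀ {m n} → m ℕ.< n → fromℕℚ m < fromℕℚ n
fromℕℚ-mono-< {m} {n} m<n rewrite fromℕℚ≡⌜⌝ m | fromℕℚ≡⌜⌝ n =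
  *<* (subst₂ ℤ._<_ (sym (ℤ.*-identityʳ (ℤ.+ m))) (sym (ℤ.*-identityʳ (ℤ.+ n))) (ℤ.+<+ m<n))

fromℕℚ-nonneg : ∀ m → 0ℚ ≤ fromℕℚ m
fromℕℚ-nonneg m = fromℕℚ-mono-≤ {0} {m} z≤n

fromℕℚ-pos : ∀ {m} → 0 ℕ.< m → 0ℚ < fromℕℚ m
fromℕℚ-pos = fromℕℚ-mono-<

0≤* : ∀ {p q} → 0ℚ ≤ p → 0ℚ ≤ q → 0ℚ ≤ p * q
0≤* {p} {q} 0≤p 0≤q = ℚ.nonNegative⁻¹ _
  {{ℚ.nonNeg*nonNeg⇒nonNeg p {{ℚ.nonNegative 0≤p}} q {{ℚ.nonNegative 0≤q}}}}

0<* : ∀ {p q} → 0ℚ < p → 0ℚ < q → 0ℚ < p * q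
0<* {p} {q} 0<p 0<q = ℚ.positive⁻¹ _ {{ℚ.pos*pos⇒pos p {{ℚ.positive 0<p}} q {{ℚ.positive 0<q}}}}

*-monoˡ-≤-0≤ : ∀ {p q} r → 0ℚ ≤ r → p ≤ q → p * r ≤ q * r
*-monoˡ-≤-0≤ r 0≤r = ℚ.*-monoʳ-≤-nonNeg r {{ℚ.nonNegative 0≤r}}

*-monoʳ-≤-0≤ : ∀ {p q} r → 0ℚ ≤ r → p ≤ q → r * p ≤ r * q
*-monoʳ-≤-0≤ r 0≤r = ℚ.*-monoˡ-≤-nonNeg r {{ℚ.nonNegative 0≤r}}

*-mono-≤-0≤ : ∀ {p q r s} → 0ℚ ≤ q → 0ℚ ≤ r → p ≤ q → r ≤ s → p * r ≤ q * s
*-mono-≤-0≤ {q = q} {r} 0≤q 0≤r p≤q r≤s =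
  ℚ.≤-trans (*-monoˡ-≤-0≤ r 0≤r p≤q) (*-monoʳ-≤-0≤ q 0≤q r≤s)

module _ {X : Set} where

  sumℚ-cong : ∀ {g h : X → ℚ} xs → (∀ x → g x ≡ h x) → sumℚ xs g ≡ sumℚ xs h
  sumℚ-cong []       g≗h = refl
  sumℚ-cong (x ∷ xs) g≗h = cong₂ _+_ (g≗h x) (sumℚ-cong xs g≗h)

  sumℚ-mono-≤ : ∀ {g h : X → ℚ} xs → (∀ x → g x ≤ h x) → sumℚ xs g ≤ sumℚ xs h
  sumℚ-mono-≤ []       g≤h = ℚ.≤-refl
  sumℚ-mono-≤ (x ∷ xs) g≤h = ℚ.+-mono-≤ (g≤h x) (sumℚ-mono-≤ xs g≤h)

  sumℚ-*ʳ : ∀ (g : X → ℚ) c xs → sumℚ xs (λ x → g x * c) ≡ sumℚ xs g * c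
  sumℚ-*ʳ g c []       = sym (ℚ.*-zeroˡ c)
  sumℚ-*ʳ g c (x ∷ xs) = trans (cong (g x * c +_) (sumℚ-*ʳ g c xs)) (sym (ℚ.*-distribʳ-+ c (g x) _))

  sumℚ-*ˡ : ∀ (g : X → ℚ) c xs → sumℚ xs (λ x → c * g x) ≡ c * sumℚ xs g
  sumℚ-*ˡ g c xs = begin
    sumℚ xs (λ x → c * g x) ≡⟨ sumℚ-cong xs (λ x → ℚ.*-comm c (g x)) ⟩
    sumℚ xs (λ x → g x * c) ≡⟨ sumℚ-*ʳ g c xs ⟩
    sumℚ xs g * c           ≡⟨ ℚ.*-comm _ c ⟩
    c * sumℚ xs g           ∎
    where open ≡-Reasoning

  sumℚ-nonneg : ∀ {g : X → ℚ} xs → (∀ x → 0ℚ ≤ g x) → 0ℚ ≤ sumℚ xs g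
  sumℚ-nonneg []       0≤g = ℚ.≤-refl
  sumℚ-nonneg (x ∷ xs) 0≤g = ℚ.+-mono-≤ (0≤g x) (sumℚ-nonneg xs 0≤g)

  ∈⇒≤sumℚ : ∀ {g : X → ℚ} {x xs} → (∀ x → 0ℚ ≤ g x) → x ∈ xs → g x ≤ sumℚ xs g
  ∈⇒≤sumℚ {g} {xs = y ∷ xs} 0≤g (here refl) =
    subst (_≤ g y + sumℚ xs g) (ℚ.+-identityʳ (g y)) (ℚ.+-monoʳ-≤ (g y) (sumℚ-nonneg xs 0≤g))
  ∈⇒≤sumℚ {g} {xs = y ∷ xs} 0≤g (there x∈xs) =
    ℚ.≤-trans (∈⇒≤sumℚ 0≤g x∈xs)
              (subst (_≤ g y + sumℚ xs g) (ℚ.+-identityˡ _) (ℚ.+-monoˡ-≤ (sumℚ xs g) (0≤g y)))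

  0<sumℚ⇒∃ : ∀ (g : X → ℚ) xs → 0ℚ < sumℚ xs g → ∃[ x ] 0ℚ < g x
  0<sumℚ⇒∃ g []       0<0 = ⊥-elim (ℚ.<-irrefl refl 0<0)
  0<sumℚ⇒∃ g (x ∷ xs) 0<Σ with 0ℚ ℚ.<? g x
  ... | yes 0<gx = x , 0<gx
  ... | no  0≮gx = 0<sumℚ⇒∃ g xs (ℚ.<-≤-trans 0<Σ
         (subst (g x + sumℚ xs g ≤_) (ℚ.+-identityˡ _) (ℚ.+-monoˡ-≤ (sumℚ xs g) (ℚ.≮⇒≥ 0≮gx))))

  fromℕℚ-sum : ∀ (g : X → ℕ) xs → fromℕℚ (sum (map g xs)) ≡ sumℚ xs (λ x → fromℕℚ (g x))
  fromℕℚ-sum g []       = refl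
  fromℕℚ-sum g (x ∷ xs) = trans (fromℕℚ-+ (g x) _) (cong (fromℕℚ (g x) +_) (fromℕℚ-sum g xs))

  maxℚ-nonneg : ∀ (g : X → ℚ) xs → 0ℚ ≤ maxℚ xs g
  maxℚ-nonneg g []       = ℚ.≤-refl
  maxℚ-nonneg g (x ∷ xs) = ℚ.≤-trans (maxℚ-nonneg g xs) (ℚ.p≤q⊔p (g x) _)

  ∈⇒≤maxℚ : ∀ (g : X → ℚ) {x xs} → x ∈ xs → g x ≤ maxℚ xs g
  ∈⇒≤maxℚ g {xs = y ∷ xs} (here refl)  = ℚ.p≤p⊔q (g y) _
  ∈⇒≤maxℚ g {xs = y ∷ xs} (there x∈xs) = ℚ.≤-trans (∈⇒≤maxℚ g x∈xs) (ℚ.p≤q⊔p (g y) _)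

  -- maxℚ starts from 0, hence the hypothesis 0 ≤ c.
  maxℚ-lub : ∀ {g : X → ℚ} {c} xs → 0ℚ ≤ c → (∀ x → g x ≤ c) → maxℚ xs g ≤ c
  maxℚ-lub []       0≤c g≤c = 0≤c
  maxℚ-lub (x ∷ xs) 0≤c g≤c = ℚ.⊔-lub (g≤c x) (maxℚ-lub xs 0≤c g≤c)

*-1/-cancel : ∀ p q .{{_ : ℚ.NonZero q}} → p * 1/ q * q ≡ p
*-1/-cancel p q = trans (ℚ.*-assoc p _ q) (trans (cong (p *_) (ℚ.*-inverseˡ q)) (ℚ.*-identityʳ p))

safeDiv-*-cancel : ∀ p {q} → q ≢ 0ℚ → safeDiv p q * q ≡ p
safeDiv-*-cancel p {q} q≢0 with q ℚ.≟ 0ℚ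
... | yes q≡0 = ⊥-elim (q≢0 q≡0)
... | no  q≢0 = *-1/-cancel p q {{ℚ.≢-nonZero q≢0}}

safeDiv-zero : ∀ q → safeDiv 0ℚ q ≡ 0ℚ
safeDiv-zero q with q ℚ.≟ 0ℚ
... | yes _   = refl
... | no  q≢0 = ℚ.*-zeroˡ ((1/ q) {{ℚ.≢-nonZero q≢0}})

safeDiv-pos : ∀ {p q} → 0ℚ < p → 0ℚ < q → 0ℚ < safeDiv p q
safeDiv-pos {p} {q} 0<p 0<q with q ℚ.≟ 0ℚ
... | yes q≡0 = ⊥-elim (ℚ.<⇒≢ 0<q (sym q≡0))
... | no  q≢0 = 0<* 0<p (ℚ.positive⁻¹ _ {{ℚ.1/pos⇒pos q {{ℚ.positive 0<q}}}})

-- Division by 0 yields 0, which lies below every nonnegative c.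
safeDiv-≤ : ∀ {p q c} → 0ℚ ≤ q → 0ℚ ≤ c → p ≤ c * q → safeDiv p q ≤ c
safeDiv-≤ {p} {q} {c} 0≤q 0≤c p≤cq with q ℚ.≟ 0ℚ
... | yes _   = 0≤c
... | no  q≢0 = ℚ.*-cancelʳ-≤-pos q {{ℚ.positive 0<q}}
                  (subst (_≤ c * q) (sym (*-1/-cancel p q {{ℚ.≢-nonZero q≢0}})) p≤cq)
  where 0<q = ℚ.≰⇒> (λ q≤0 → q≢0 (ℚ.≤-antisym q≤0 0≤q))

≤-safeDiv : ∀ {p q c} → 0ℚ < q → c * q ≤ p → c ≤ safeDiv p q
≤-safeDiv {p} {q} {c} 0<q cq≤p = ℚ.*-cancelʳ-≤-pos q {{ℚ.positive 0<q}}
  (subst (c * q ≤_) (sym (safeDiv-*-cancel p (ℚ.<⇒≢ 0<q ∘ sym))) cq≤p)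

safeDiv-≤-safeDiv⇒ : ∀ {p q r s} → 0ℚ < q → 0ℚ < s →
                     safeDiv p q ≤ safeDiv r s → p * s ≤ r * q
safeDiv-≤-safeDiv⇒ {p} {q} {r} {s} 0<q 0<s le = begin
  p * s                ≡⟨ cong (_* s) (safeDiv-*-cancel p (ℚ.<⇒≢ 0<q ∘ sym)) ⟨
  safeDiv p q * q * s  ≤⟨ *-monoˡ-≤-0≤ s (ℚ.<⇒≤ 0<s) (*-monoˡ-≤-0≤ q (ℚ.<⇒≤ 0<q) le) ⟩
  safeDiv r s * q * s  ≡⟨ *-rightComm (safeDiv r s) q s ⟩
  safeDiv r s * s * q  ≡⟨ cong (_* q) (safeDiv-*-cancel r (ℚ.<⇒≢ 0<s ∘ sym)) ⟩
  r * q                ∎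
  where open ℚ.≤-Reasoning

inverse-product-≤ : ∀ {p q x y e} → 0ℚ < p → 0ℚ < q → 0ℚ < x → 0ℚ < y →
                    x ≤ p * e → y ≤ q * e → safeDiv 1ℚ (p * q) ≤ safeDiv (e * e) (x * y)
inverse-product-≤ {p} {q} {x} {y} {e} 0<p 0<q 0<x 0<y x≤pe y≤qe = ≤-safeDiv (0<* 0<x 0<y) (begin
  1/pq * (x * y)            ≤⟨ *-monoʳ-≤-0≤ 1/pq 0≤1/pq (*-mono-≤-0≤ 0≤pe (ℚ.<⇒≤ 0<y) x≤pe y≤qe) ⟩
  1/pq * (p * e * (q * e))  ≡⟨ cong (1/pq *_) (*-interchange p e q e) ⟩
  1/pq * (p * q * (e * e))  ≡⟨ ℚ.*-assoc 1/pq _ _ ⟨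
  1/pq * (p * q) * (e * e)  ≡⟨ cong (_* (e * e)) (safeDiv-*-cancel 1ℚ (ℚ.<⇒≢ (0<* 0<p 0<q) ∘ sym)) ⟩
  1ℚ * (e * e)              ≡⟨ ℚ.*-identityˡ _ ⟩
  e * e                     ∎)
  where
  open ℚ.≤-Reasoning
  1/pq = safeDiv 1ℚ (p * q)
  0≤1/pq = ℚ.<⇒≤ (safeDiv-pos (ℚ.positive⁻¹ 1ℚ) (0<* 0<p 0<q))
  0≤pe = ℚ.≤-trans (ℚ.<⇒≤ 0<x) x≤pe

quarter-identity : ∀ {R x y e ε} → R * (x * y) ≡ e * e → e * ε ≡ 1ℚ →
                   ½ * ½ * R * (fromℕℚ 2 * x * ε * (fromℕℚ 2 * y * ε)) ≡ 1ℚ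
quarter-identity {R} {x} {y} {e} {ε} R*xy≡e*e e*ε≡1 = begin
  ½ * ½ * R * (fromℕℚ 2 * x * ε * (fromℕℚ 2 * y * ε)) ≡⟨ regroup R x y ε ⟩
  R * (x * y) * (ε * ε)                               ≡⟨ cong (_* (ε * ε)) R*xy≡e*e ⟩
  e * e * (ε * ε)                                     ≡⟨ *-interchange e e ε ε ⟩
  e * ε * (e * ε)                                     ≡⟨ cong₂ _*_ e*ε≡1 e*ε≡1 ⟩
  1ℚ                                                  ∎
  where
  open ≡-Reasoning
  regroup : ∀ R x y ε → ½ * ½ * R * (fromℕℚ 2 * x * ε * (fromℕℚ 2 * y * ε)) ≡ R * (x * y) * (ε * ε)
  regroup = solve 4 (λ R x y ε → con ½ :* con ½ :* R :* (con (fromℕℚ 2) :* x :* ε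
                                                          :* (con (fromℕℚ 2) :* y :* ε))
                                 := R :* (x :* y) :* (ε :* ε)) refl
    where open +-*-Solver

-- Conditional probabilities

degree : ∀ {n} → (Vec Bool n → Vec Bool n → Bool) → Vec Bool n → ℕ
degree E a = ∑ (λ b → 𝟙 (E a b))

-- For w = μ D, conditional and maxConditional are condA D and maxCondA D;
-- for w = flip (μ D) they are condB D and maxCondB D (all definitionally).
module _ {n : ℕ} (w : Vec Bool n → Vec Bool n → ℚ) where

  mass : Vec Bool n → ℚ
  mass a = sumℚ (allVecs n) (w a)

  conditional : Vec Bool n → Fin n → ℚ
  conditional a i = safeDiv (w a (flipAt a i)) (mass a)

  maxConditional : ℚ
  maxConditional = maxℚ (allVecs n) (λ a → maxℚ (allFin n) (conditional a))

  support : Vec Bool n → Bool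
  support a = ⌊ 0ℚ ℚ.<? mass a ⌋

  support-elim : ∀ {a} → support a ≡ true → ∃[ b ] 0ℚ < w a b
  support-elim {a} a∈S with 0ℚ ℚ.<? mass a
  ... | yes 0<mass = 0<sumℚ⇒∃ (w a) (allVecs n) 0<mass

module _ {n : ℕ} {w : Vec Bool n → Vec Bool n → ℚ}
         (w-nonneg : ∀ a b → 0ℚ ≤ w a b)
         (w-adjacent : ∀ a b → 0ℚ < w a b → hamming a b ≡ 1) where

  mass-nonneg : ∀ a → 0ℚ ≤ mass w a
  mass-nonneg a = sumℚ-nonneg (allVecs n) (w-nonneg a)

  ≤mass : ∀ a b → w a b ≤ mass w a
  ≤mass a b = ∈⇒≤sumℚ (w-nonneg a) (∈-allVecs b)

  maxConditional-nonneg : 0ℚ ≤ maxConditional w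
  maxConditional-nonneg = maxℚ-nonneg (λ a → maxℚ (allFin n) (conditional w a)) (allVecs n)

  conditional≤maxConditional : ∀ a i → conditional w a i ≤ maxConditional w
  conditional≤maxConditional a i =
    ℚ.≤-trans (∈⇒≤maxℚ (conditional w a) (∈-allFin i))
              (∈⇒≤maxℚ (λ a → maxℚ (allFin n) (conditional w a)) (∈-allVecs a))

  ≤maxConditional*mass : ∀ a b → w a b ≤ maxConditional w * mass w a
  ≤maxConditional*mass a b with 0ℚ ℚ.<? w a b
  ... | no  0≮w = ℚ.≤-trans (ℚ.≮⇒≥ 0≮w) (0≤* maxConditional-nonneg (mass-nonneg a))
  ... | yes 0<w with hamming≡1⇒flipAt a b (w-adjacent a b 0<w)
  ...   | i , refl = begin
    w a b                         ≡⟨ safeDiv-*-cancel (w a b) (ℚ.<⇒≢ 0<mass ∘ sym) ⟨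
    conditional w a i * mass w a  ≤⟨ *-monoˡ-≤-0≤ (mass w a) (mass-nonneg a) (conditional≤maxConditional a i) ⟩
    maxConditional w * mass w a   ∎
    where
    open ℚ.≤-Reasoning
    0<mass = ℚ.<-≤-trans 0<w (≤mass a b)

  support-intro : ∀ {a b} → 0ℚ < w a b → support w a ≡ true
  support-intro {a} {b} 0<w with 0ℚ ℚ.<? mass w a
  ... | yes _      = refl
  ... | no  0≮mass = ⊥-elim (0≮mass (ℚ.<-≤-trans 0<w (≤mass a b)))

  maxConditional-pos : ∀ {a b} → 0ℚ < w a b → 0ℚ < maxConditional w
  maxConditional-pos {a} {b} 0<w with hamming≡1⇒flipAt a b (w-adjacent a b 0<w)
  ... | i , refl = ℚ.<-≤-trans (safeDiv-pos 0<w (ℚ.<-≤-trans 0<w (≤mass a b)))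
                               (conditional≤maxConditional a i)

  module _ (E : Vec Bool n → Vec Bool n → Bool) (w⊆E : ∀ a b → 0ℚ < w a b → E a b ≡ true) where

    ≤maxConditional*mass*𝟙 : ∀ a b → w a b ≤ maxConditional w * mass w a * fromℕℚ (𝟙 (E a b))
    ≤maxConditional*mass*𝟙 a b = by-cases (0ℚ ℚ.<? w a b)
      where
      by-cases : Dec (0ℚ < w a b) → w a b ≤ maxConditional w * mass w a * fromℕℚ (𝟙 (E a b))
      by-cases (no 0≮w)  = ℚ.≤-trans (ℚ.≮⇒≥ 0≮w)
        (0≤* (0≤* maxConditional-nonneg (mass-nonneg a)) (fromℕℚ-nonneg (𝟙 (E a b))))
      by-cases (yes 0<w) = subst (λ x → w a b ≤ maxConditional w * mass w a * fromℕℚ (𝟙 x))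
                                 (sym (w⊆E a b 0<w))
                                 (subst (w a b ≤_) (sym (ℚ.*-identityʳ _)) (≤maxConditional*mass a b))

    1≤maxConditional*degree : ∀ a → 0ℚ < mass w a → 1ℚ ≤ maxConditional w * fromℕℚ (degree E a)
    1≤maxConditional*degree a 0<mass = ℚ.*-cancelˡ-≤-pos (mass w a) {{ℚ.positive 0<mass}} (begin
      mass w a * 1ℚ                                       ≡⟨ ℚ.*-identityʳ _ ⟩
      mass w a                                            ≤⟨ sumℚ-mono-≤ (allVecs n) (≤maxConditional*mass*𝟙 a) ⟩
      sumℚ (allVecs n) (λ b → M * mass w a * fromℕℚ (𝟙 (E a b)))
        ≡⟨ sumℚ-*ˡ _ (M * mass w a) (allVecs n) ⟩
      M * mass w a * sumℚ (allVecs n) (λ b → fromℕℚ (𝟙 (E a b)))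
        ≡⟨ cong (M * mass w a *_) (fromℕℚ-sum _ (allVecs n)) ⟨
      M * mass w a * fromℕℚ (degree E a)                  ≡⟨ cong (_* fromℕℚ (degree E a)) (ℚ.*-comm M _) ⟩
      mass w a * M * fromℕℚ (degree E a)                  ≡⟨ ℚ.*-assoc (mass w a) M _ ⟩
      mass w a * (M * fromℕℚ (degree E a))                ∎)
      where
      open ℚ.≤-Reasoning
      M = maxConditional w

    support-size-≤ : fromℕℚ (count (support w)) ≤ maxConditional w * fromℕℚ (∑ (degree E))
    support-size-≤ = begin
      fromℕℚ (count (support w))                         ≡⟨ cong fromℕℚ (count≡∑ (support w)) ⟩
      fromℕℚ (∑ (λ a → 𝟙 (support w a)))                 ≡⟨ fromℕℚ-sum _ (allVecs n) ⟩
      sumℚ (allVecs n) (λ a → fromℕℚ (𝟙 (support w a)))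
        ≤⟨ sumℚ-mono-≤ (allVecs n) (λ a → per-vertex a (0ℚ ℚ.<? mass w a)) ⟩
      sumℚ (allVecs n) (λ a → M * fromℕℚ (degree E a))   ≡⟨ sumℚ-*ˡ _ M (allVecs n) ⟩
      M * sumℚ (allVecs n) (λ a → fromℕℚ (degree E a))   ≡⟨ cong (M *_) (fromℕℚ-sum (degree E) (allVecs n)) ⟨
      M * fromℕℚ (∑ (degree E))                          ∎
      where
      open ℚ.≤-Reasoning
      M = maxConditional w
      per-vertex : ∀ a (d : Dec (0ℚ < mass w a)) → fromℕℚ (𝟙 ⌊ d ⌋) ≤ M * fromℕℚ (degree E a)
      per-vertex a (no _)       = 0≤* maxConditional-nonneg (fromℕℚ-nonneg (degree E a))
      per-vertex a (yes 0<mass) = 1≤maxConditional*degree a 0<mass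

module _ {n : ℕ} where

  edge : (A B : Vec Bool n → Bool) → Vec Bool n → Vec Bool n → Bool
  edge A B a b = A a ∧ B b ∧ ⌊ hamming a b ℕ.≟ 1 ⌋

  edge-intro : ∀ {A B a b} → A a ≡ true → B b ≡ true → hamming a b ≡ 1 → edge A B a b ≡ true
  edge-intro Aa Bb d rewrite Aa | Bb | d = refl

  edge-elim : ∀ A B a b → edge A B a b ≡ true → A a ≡ true × B b ≡ true × hamming a b ≡ 1
  edge-elim A B a b ab∈E with A a | B b | hamming a b ℕ.≟ 1
  ... | true | true | yes d = refl , refl , d

  edge-congˡ : ∀ A A′ B a b → A a ≡ A′ a → edge A B a b ≡ edge A′ B a b
  edge-congˡ A A′ B a b = cong (λ z → z ∧ B b ∧ ⌊ hamming a b ℕ.≟ 1 ⌋)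

  edge-absent : ∀ A B a b → A a ≡ false → edge A B a b ≡ false
  edge-absent A B a b = cong (λ z → z ∧ B b ∧ ⌊ hamming a b ℕ.≟ 1 ⌋)

  edge-flip : ∀ A B a b → edge B A b a ≡ edge A B a b
  edge-flip A B a b rewrite hamming-sym b a with A a | B b
  ... | true  | true  = refl
  ... | true  | false = refl
  ... | false | true  = refl
  ... | false | false = refl

  edge⇒edges-pos : ∀ A B {a b} → edge A B a b ≡ true → 0 ℕ.< edges A B
  edge⇒edges-pos A B {a} {b} ab∈E = ℕ.≤-trans (ℕ.≤-reflexive (cong 𝟙 (sym ab∈E)))
    (ℕ.≤-trans (∈⇒≤sum-map (λ b → 𝟙 (edge A B a b)) (∈-allVecs b))
               (∈⇒≤sum-map (degree (edge A B)) (∈-allVecs a)))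

  edges-comm : ∀ A B → edges A B ≡ edges B A
  edges-comm A B = trans (sum-map-swap (λ a b → 𝟙 (edge A B a b)) (allVecs n) (allVecs n))
                         (∑-cong (λ b → ∑-cong (λ a → cong 𝟙 (sym (edge-flip A B a b)))))

  count-pos : ∀ (P : Vec Bool n → Bool) {x} → P x ≡ true → 0 ℕ.< count P
  count-pos P {x} Px rewrite count≡∑ P = subst (λ b → 𝟙 b ℕ.≤ ∑ (λ y → 𝟙 (P y))) Px
                                               (∈⇒≤sum-map (λ y → 𝟙 (P y)) (∈-allVecs x))

  count-pos⇒∃ : ∀ (P : Vec Bool n → Bool) → 0 ℕ.< count P → ∃[ x ] P x ≡ true
  count-pos⇒∃ P 0<count rewrite count≡∑ P with 0<sum-map⇒∃ (λ y → 𝟙 (P y)) (allVecs n) 0<count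
  ... | x , 0<Px with P x in Px
  ...   | true = x , Px

  ratio-comm : ∀ A B → ratio A B ≡ ratio B A
  ratio-comm A B = cong₂ (λ e c → safeDiv (fromℕℚ (e ℕ.* e)) (fromℕℚ c))
                         (edges-comm A B) (ℕ.*-comm (count A) (count B))

  ratio-pos : ∀ {A B : Vec Bool n → Bool} →
              0 ℕ.< edges A B → 0 ℕ.< count A → 0 ℕ.< count B → 0ℚ < ratio A B
  ratio-pos 0<e 0<|A| 0<|B| =
    safeDiv-pos (fromℕℚ-pos (ℕ.*-mono-≤ 0<e 0<e)) (fromℕℚ-pos (ℕ.*-mono-≤ 0<|A| 0<|B|))

  ratio-zero : ∀ {A B : Vec Bool n → Bool} → edges A B ≡ 0 → ratio A B ≡ 0ℚ
  ratio-zero {A} {B} e≡0 rewrite e≡0 = safeDiv-zero (fromℕℚ (count A ℕ.* count B))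

  ratio-*-counts : ∀ {A B : Vec Bool n → Bool} → 0 ℕ.< count A ℕ.* count B →
    ratio A B * (fromℕℚ (count A) * fromℕℚ (count B)) ≡ fromℕℚ (edges A B) * fromℕℚ (edges A B)
  ratio-*-counts {A} {B} 0<c = begin
    ratio A B * (fromℕℚ (count A) * fromℕℚ (count B)) ≡⟨ cong (ratio A B *_) (fromℕℚ-* (count A) (count B)) ⟨
    ratio A B * fromℕℚ (count A ℕ.* count B)         ≡⟨ safeDiv-*-cancel _ (ℚ.<⇒≢ (fromℕℚ-pos 0<c) ∘ sym) ⟩
    fromℕℚ (edges A B ℕ.* edges A B)                 ≡⟨ fromℕℚ-* (edges A B) (edges A B) ⟩
    fromℕℚ (edges A B) * fromℕℚ (edges A B)          ∎
    where open ≡-Reasoning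

  ratio-≤⇒ : ∀ {A B A′ B′ : Vec Bool n → Bool} →
    0 ℕ.< count A′ ℕ.* count B′ → 0 ℕ.< count A ℕ.* count B → ratio A′ B′ ≤ ratio A B →
    edges A′ B′ ℕ.* edges A′ B′ ℕ.* (count A ℕ.* count B)
      ℕ.≤ edges A B ℕ.* edges A B ℕ.* (count A′ ℕ.* count B′)
  ratio-≤⇒ {A} {B} {A′} {B′} 0<c′ 0<c le = fromℕℚ-cancel-≤
    (subst₂ _≤_ (sym (fromℕℚ-* (e′ ℕ.* e′) c)) (sym (fromℕℚ-* (e ℕ.* e) c′))
            (safeDiv-≤-safeDiv⇒ (fromℕℚ-pos 0<c′) (fromℕℚ-pos 0<c) le))
    where
    e = edges A B
    e′ = edges A′ B′
    c = count A ℕ.* count B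
    c′ = count A′ ℕ.* count B′

-- K∞ ≤ K

module _ {n : ℕ} {f : Vec Bool n → Bool} (D : KhrapchenkoDist f) where
  open KhrapchenkoDist D renaming (support to μ-support)

  private
    μ-adjacent : ∀ a b → 0ℚ < μ a b → hamming a b ≡ 1
    μ-adjacent a b 0<μ = proj₂ (proj₂ (μ-support a b 0<μ))

    μᵀ-adjacent : ∀ b a → 0ℚ < μ a b → hamming b a ≡ 1
    μᵀ-adjacent b a 0<μ = trans (hamming-sym b a) (μ-adjacent a b 0<μ)

  ∃-positive : ∃[ a ] ∃[ b ] 0ℚ < μ a b
  ∃-positive with 0<sumℚ⇒∃ (mass μ) (allVecs n) (subst (0ℚ <_) (sym total) (ℚ.positive⁻¹ 1ℚ))
  ... | a , 0<mass with 0<sumℚ⇒∃ (μ a) (allVecs n) 0<mass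
  ...   | b , 0<μ = a , b , 0<μ

  0<maxCondA : 0ℚ < maxCondA D
  0<maxCondA = maxConditional-pos nonneg μ-adjacent (proj₂ (proj₂ ∃-positive))

  0<maxCondB : 0ℚ < maxCondB D
  0<maxCondB = maxConditional-pos (flip nonneg) μᵀ-adjacent (proj₂ (proj₂ ∃-positive))

  minEntropyValue≤ratio : ∃[ A ] ∃[ B ] Admissible f A B × minEntropyValue D ≤ ratio A B
  minEntropyValue≤ratio = SA , SB , (SA⊆f⁻¹1 , SB⊆f⁻¹0 , 0<|SA| , 0<|SB|) , bound
    where
    SA SB : Vec Bool n → Bool
    SA = support μ
    SB = support (flip μ)
    E = edge SA SB
    0<μ₀ = proj₂ (proj₂ ∃-positive)

    μ⊆E : ∀ a b → 0ℚ < μ a b → E a b ≡ true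
    μ⊆E a b 0<μ = edge-intro {A = SA} {SB} {a} {b} (support-intro nonneg μ-adjacent 0<μ)
                             (support-intro (flip nonneg) μᵀ-adjacent 0<μ) (μ-adjacent a b 0<μ)

    SA⊆f⁻¹1 : ∀ a → SA a ≡ true → f a ≡ true
    SA⊆f⁻¹1 a a∈SA = proj₁ (μ-support a _ (proj₂ (support-elim μ a∈SA)))

    SB⊆f⁻¹0 : ∀ b → SB b ≡ true → f b ≡ false
    SB⊆f⁻¹0 b b∈SB = proj₁ (proj₂ (μ-support _ b (proj₂ (support-elim (flip μ) b∈SB))))

    0<|SA| = count-pos SA (support-intro nonneg μ-adjacent 0<μ₀)
    0<|SB| = count-pos SB (support-intro (flip nonneg) μᵀ-adjacent 0<μ₀)

    |SA|≤ : fromℕℚ (count SA) ≤ maxCondA D * fromℕℚ (edges SA SB)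
    |SA|≤ = support-size-≤ nonneg μ-adjacent E μ⊆E

    |SB|≤ : fromℕℚ (count SB) ≤ maxCondB D * fromℕℚ (edges SA SB)
    |SB|≤ = subst (λ m → fromℕℚ (count SB) ≤ maxCondB D * fromℕℚ m)
                  (sym (sum-map-swap (λ a b → 𝟙 (E a b)) (allVecs n) (allVecs n)))
                  (support-size-≤ (flip nonneg) μᵀ-adjacent (flip E) (flip μ⊆E))

    bound : minEntropyValue D ≤ ratio SA SB
    bound = subst (minEntropyValue D ≤_)
      (sym (cong₂ safeDiv (fromℕℚ-* (edges SA SB) (edges SA SB)) (fromℕℚ-* (count SA) (count SB))))
      (inverse-product-≤ 0<maxCondA 0<maxCondB (fromℕℚ-pos 0<|SA|) (fromℕℚ-pos 0<|SB|) |SA|≤ |SB|≤)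

-- Minimum degree in an optimal pair

module _ {n : ℕ} where
  open import Data.Vec.Properties using (≡-dec)
  import Data.Bool.Properties as Bool

  _≟ᵥ_ : (x y : Vec Bool n) → Dec (x ≡ y)
  _≟ᵥ_ = ≡-dec Bool._≟_

  singleton : Vec Bool n → Vec Bool n → Bool
  singleton v x = ⌊ x ≟ᵥ v ⌋

  singleton-self : ∀ v → singleton v v ≡ true
  singleton-self v with v ≟ᵥ v
  ... | yes _   = refl
  ... | no  v≢v = ⊥-elim (v≢v refl)

  singleton-elim : ∀ {v x} → singleton v x ≡ true → x ≡ v
  singleton-elim {v} {x} x∈v with x ≟ᵥ v
  ... | yes x≡v = x≡v

  remove : Vec Bool n → (Vec Bool n → Bool) → Vec Bool n → Bool
  remove a A x = A x ∧ not (singleton a x)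

  remove-self : ∀ a A → remove a A a ≡ false
  remove-self a A rewrite singleton-self a = Bool.∧-zeroʳ (A a)

  remove-other : ∀ {a x} A → x ≢ a → remove a A x ≡ A x
  remove-other {a} {x} A x≢a with x ≟ᵥ a
  ... | yes x≡a = ⊥-elim (x≢a x≡a)
  ... | no  _   = Bool.∧-identityʳ (A x)

  remove-⊆ : ∀ {a} A x → remove a A x ≡ true → A x ≡ true
  remove-⊆ A x x∈A∖a with A x
  ... | true = refl

  count-remove : ∀ {a} A → A a ≡ true → count A ≡ suc (count (remove a A))
  count-remove {a} A Aa = begin
    count A                                ≡⟨ count≡∑ A ⟩
    ∑ (λ x → 𝟙 (A x))                      ≡⟨ ∑-extract _ (λ x → 𝟙 (remove a A x)) a
                                                (λ x x≢a → cong 𝟙 (sym (remove-other A x≢a)))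
                                                (cong 𝟙 (remove-self a A)) ⟩
    𝟙 (A a) ℕ.+ ∑ (λ x → 𝟙 (remove a A x)) ≡⟨ cong₂ ℕ._+_ (cong 𝟙 Aa) (sym (count≡∑ (remove a A))) ⟩
    suc (count (remove a A))               ∎
    where open ≡-Reasoning

  edges-remove : ∀ a A B → edges A B ≡ degree (edge A B) a ℕ.+ edges (remove a A) B
  edges-remove a A B = ∑-extract (degree (edge A B)) (degree (edge (remove a A) B)) a
    (λ x x≢a → ∑-cong (λ b → cong 𝟙 (edge-congˡ A (remove a A) B x b (sym (remove-other A x≢a)))))
    (sum-map-zero _ (allVecs n) (λ b → cong 𝟙 (edge-absent (remove a A) B a b (remove-self a A))))

  edges-empty : ∀ A B → count A ≡ 0 → edges A B ≡ 0
  edges-empty A B |A|≡0 = sum-map-zero _ (allVecs n) λ a → sum-map-zero _ (allVecs n) λ b →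
    cong 𝟙 (edge-absent A B a b (A-false a))
    where
    A-false : ∀ a → A a ≡ false
    A-false a with A a in Aa
    ... | false = refl
    ... | true  = ⊥-elim (ℕ.<-irrefl refl (subst (0 ℕ.<_) |A|≡0 (count-pos A Aa)))

  -- Compare (A, B) with (A ∖ {a}, B): writing d = deg a, r = |E| − d and
  -- m = |A| − 1, maximality gives r² (m + 1) ≤ (d + r)² m.
  minimum-degree : ∀ A B → 0 ℕ.< count B →
    (∀ A′ → (∀ x → A′ x ≡ true → A x ≡ true) → 0 ℕ.< count A′ → ratio A′ B ≤ ratio A B) →
    ∀ a → A a ≡ true → edges A B ℕ.≤ 2 ℕ.* count A ℕ.* degree (edge A B) a
  minimum-degree A B 0<|B| maximal a Aa =
    subst₂ (λ e c → e ℕ.≤ 2 ℕ.* c ℕ.* d) (sym (edges-remove a A B)) (sym (count-remove A Aa))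
           (vertex-removal-bound d r m removal-inequality)
    where
    A′ = remove a A
    d = degree (edge A B) a
    r = edges A′ B
    m = count A′
    |B| = count B

    removal-inequality : r ℕ.* r ℕ.* suc m ℕ.≤ (d ℕ.+ r) ℕ.* (d ℕ.+ r) ℕ.* m
    removal-inequality = by-cases (m ℕ.≟ 0)
      where
      by-cases : Dec (m ≡ 0) → r ℕ.* r ℕ.* suc m ℕ.≤ (d ℕ.+ r) ℕ.* (d ℕ.+ r) ℕ.* m
      by-cases (yes m≡0) = subst (λ r → r ℕ.* r ℕ.* suc m ℕ.≤ (d ℕ.+ r) ℕ.* (d ℕ.+ r) ℕ.* m)
                                 (sym (edges-empty A′ B m≡0)) z≤n
      by-cases (no m≢0) = ℕ.*-cancelʳ-≤ _ _ |B| {{ℕ.>-nonZero 0<|B|}}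
        (subst₂ ℕ._≤_ (sym (ℕ.*-assoc (r ℕ.* r) (suc m) |B|))
                      (sym (ℕ.*-assoc ((d ℕ.+ r) ℕ.* (d ℕ.+ r)) m |B|))
          (subst₂ (λ e c → r ℕ.* r ℕ.* (c ℕ.* |B|) ℕ.≤ e ℕ.* e ℕ.* (m ℕ.* |B|))
                  (edges-remove a A B) (count-remove A Aa)
                  (ratio-≤⇒ {A = A} {B} {A′} {B} (ℕ.*-mono-≤ 0<m 0<|B|) (ℕ.*-mono-≤ (count-pos A Aa) 0<|B|)
                            (maximal A′ (remove-⊆ A) 0<m))))
        where 0<m = ℕ.n≢0⇒n>0 m≢0

-- K / 4 ≤ K∞

module Uniform {n : ℕ} (e : ℕ) (0<e : 0 ℕ.< e) where
  private
    instance
      e-nonZero : ℚ.NonZero (fromℕℚ e)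
      e-nonZero = ℚ.pos⇒nonZero (fromℕℚ e) {{ℚ.positive (fromℕℚ-pos 0<e)}}

  ε : ℚ
  ε = 1/ fromℕℚ e

  e*ε≡1 : fromℕℚ e * ε ≡ 1ℚ
  e*ε≡1 = ℚ.*-inverseʳ (fromℕℚ e)

  0≤ε : 0ℚ ≤ ε
  0≤ε = ℚ.<⇒≤ (ℚ.positive⁻¹ ε {{ℚ.1/pos⇒pos (fromℕℚ e) {{ℚ.positive (fromℕℚ-pos 0<e)}}}})

  uniform : (Vec Bool n → Vec Bool n → Bool) → Vec Bool n → Vec Bool n → ℚ
  uniform E a b = fromℕℚ (𝟙 (E a b)) * ε

  uniform-nonneg : ∀ E a b → 0ℚ ≤ uniform E a b
  uniform-nonneg E a b = 0≤* (fromℕℚ-nonneg (𝟙 (E a b))) 0≤ε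

  uniform-pos⇒edge : ∀ E a b → 0ℚ < uniform E a b → E a b ≡ true
  uniform-pos⇒edge E a b 0<u with E a b
  ... | true  = refl
  ... | false = ⊥-elim (ℚ.<-irrefl (sym (ℚ.*-zeroˡ ε)) 0<u)

  mass-uniform : ∀ E a → mass (uniform E) a ≡ fromℕℚ (degree E a) * ε
  mass-uniform E a = trans (sumℚ-*ʳ (λ b → fromℕℚ (𝟙 (E a b))) ε (allVecs n))
                           (cong (_* ε) (sym (fromℕℚ-sum _ (allVecs n))))

  total-uniform : ∀ E → ∑ (degree E) ≡ e → sumℚ (allVecs n) (mass (uniform E)) ≡ 1ℚ
  total-uniform E ∑deg≡e = begin
    sumℚ (allVecs n) (mass (uniform E))               ≡⟨ sumℚ-cong (allVecs n) (mass-uniform E) ⟩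
    sumℚ (allVecs n) (λ a → fromℕℚ (degree E a) * ε)  ≡⟨ sumℚ-*ʳ (λ a → fromℕℚ (degree E a)) ε (allVecs n) ⟩
    sumℚ (allVecs n) (λ a → fromℕℚ (degree E a)) * ε  ≡⟨ cong (_* ε) (fromℕℚ-sum (degree E) (allVecs n)) ⟨
    fromℕℚ (∑ (degree E)) * ε                         ≡⟨ cong (λ m → fromℕℚ m * ε) ∑deg≡e ⟩
    fromℕℚ e * ε                                      ≡⟨ e*ε≡1 ⟩
    1ℚ                                                ∎
    where open ≡-Reasoning

  maxConditional-uniform-≤ : ∀ E c → (∀ a b → E a b ≡ true → e ℕ.≤ c ℕ.* degree E a) →
                             maxConditional (uniform E) ≤ fromℕℚ c * ε
  maxConditional-uniform-≤ E c e≤c*deg =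
    maxℚ-lub (allVecs n) 0≤cε λ a → maxℚ-lub (allFin n) 0≤cε λ i →
      safeDiv-≤ (sumℚ-nonneg (allVecs n) (uniform-nonneg E a)) 0≤cε
                (subst (λ m → uniform E a (flipAt a i) ≤ fromℕℚ c * ε * m) (sym (mass-uniform E a))
                       (per-edge a (flipAt a i)))
    where
    0≤cε = 0≤* (fromℕℚ-nonneg c) 0≤ε

    per-edge : ∀ a b → uniform E a b ≤ fromℕℚ c * ε * (fromℕℚ (degree E a) * ε)
    per-edge a b with E a b in ab∈E
    ... | false = subst (_≤ fromℕℚ c * ε * (fromℕℚ (degree E a) * ε)) (sym (ℚ.*-zeroˡ ε))
                        (0≤* 0≤cε (0≤* (fromℕℚ-nonneg (degree E a)) 0≤ε))
    ... | true  = begin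
      1ℚ * ε                                  ≡⟨ cong (_* ε) e*ε≡1 ⟨
      fromℕℚ e * ε * ε                        ≤⟨ *-monoˡ-≤-0≤ ε 0≤ε (*-monoˡ-≤-0≤ ε 0≤ε
                                                   (subst (fromℕℚ e ≤_) (fromℕℚ-* c (degree E a))
                                                          (fromℕℚ-mono-≤ (e≤c*deg a b ab∈E)))) ⟩
      fromℕℚ c * fromℕℚ (degree E a) * ε * ε  ≡⟨ ℚ.*-assoc (fromℕℚ c * fromℕℚ (degree E a)) ε ε ⟩
      fromℕℚ c * fromℕℚ (degree E a) * (ε * ε) ≡⟨ *-interchange (fromℕℚ c) _ ε ε ⟩
      fromℕℚ c * ε * (fromℕℚ (degree E a) * ε) ∎
      where open ℚ.≤-Reasoning

module _ {n : ℕ} {f : Vec Bool n → Bool} {A B : Vec Bool n → Bool} (adm : Admissible f A B)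
         (maximal : ∀ A′ B′ → Admissible f A′ B′ → ratio A′ B′ ≤ ratio A B) where
  private
    A⊆f⁻¹1 = proj₁ adm
    B⊆f⁻¹0 = proj₁ (proj₂ adm)
    0<|A| = proj₁ (proj₂ (proj₂ adm))
    0<|B| = proj₂ (proj₂ (proj₂ adm))

  -- A bichromatic edge {a′, b′} gives the admissible pair ({a′}, {b′}) of positive ratio.
  edges-pos : 0 ℕ.< edges A B
  edges-pos = ℕ.n≢0⇒n>0 λ e≡0 → ℚ.<-irrefl refl
    (ℚ.<-≤-trans 0<ratio₁ (subst (ratio A₁ B₁ ≤_) (ratio-zero {A = A} {B} e≡0) (maximal A₁ B₁ adm₁)))
    where
    a = proj₁ (count-pos⇒∃ A 0<|A|)
    b = proj₁ (count-pos⇒∃ B 0<|B|)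
    bichromatic = ∃-bichromatic-edge f (A⊆f⁻¹1 a (proj₂ (count-pos⇒∃ A 0<|A|)))
                                       (B⊆f⁻¹0 b (proj₂ (count-pos⇒∃ B 0<|B|)))
    a′ = proj₁ bichromatic
    b′ = proj₁ (proj₂ bichromatic)
    fa′ = proj₁ (proj₂ (proj₂ bichromatic))
    fb′ = proj₁ (proj₂ (proj₂ (proj₂ bichromatic)))
    a′b′-adjacent = proj₂ (proj₂ (proj₂ (proj₂ bichromatic)))
    A₁ = singleton a′
    B₁ = singleton b′
    adm₁ : Admissible f A₁ B₁
    adm₁ = (λ x x∈A₁ → subst (λ z → f z ≡ true) (sym (singleton-elim x∈A₁)) fa′)
         , (λ x x∈B₁ → subst (λ z → f z ≡ false) (sym (singleton-elim x∈B₁)) fb′)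
         , count-pos A₁ (singleton-self a′) , count-pos B₁ (singleton-self b′)
    0<ratio₁ : 0ℚ < ratio A₁ B₁
    0<ratio₁ = ratio-pos {A = A₁} {B₁}
      (edge⇒edges-pos A₁ B₁ {a′} {b′}
        (edge-intro {A = A₁} {B₁} {a′} {b′} (singleton-self a′) (singleton-self b′) a′b′-adjacent))
      (proj₁ (proj₂ (proj₂ adm₁))) (proj₂ (proj₂ (proj₂ adm₁)))

  open Uniform {n} (edges A B) edges-pos

  uniformDist : KhrapchenkoDist f
  uniformDist = record
    { μ       = uniform (edge A B)
    ; nonneg  = uniform-nonneg (edge A B)
    ; total   = total-uniform (edge A B) refl
    ; support = λ a b 0<μ → let Aa , Bb , d = edge-elim A B a b (uniform-pos⇒edge (edge A B) a b 0<μ)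
                            in A⊆f⁻¹1 a Aa , B⊆f⁻¹0 b Bb , d
    }

  private
    maxCondA≤ : maxCondA uniformDist ≤ fromℕℚ (2 ℕ.* count A) * ε
    maxCondA≤ = maxConditional-uniform-≤ (edge A B) (2 ℕ.* count A) λ a b ab∈E →
      minimum-degree A B 0<|B|
        (λ A′ A′⊆A 0<|A′| → maximal A′ B ((λ x → A⊆f⁻¹1 x ∘ A′⊆A x) , B⊆f⁻¹0 , 0<|A′| , 0<|B|))
        a (proj₁ (edge-elim A B a b ab∈E))

    maxCondB≤ : maxCondB uniformDist ≤ fromℕℚ (2 ℕ.* count B) * ε
    maxCondB≤ = maxConditional-uniform-≤ (flip (edge A B)) (2 ℕ.* count B) λ b a ab∈E →
      subst₂ (λ e d → e ℕ.≤ 2 ℕ.* count B ℕ.* d) (sym (edges-comm A B))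
             (∑-cong (λ a → cong 𝟙 (edge-flip A B a b)))
        (minimum-degree B A 0<|A|
          (λ B′ B′⊆B 0<|B′| → subst₂ _≤_ (ratio-comm A B′) (ratio-comm A B)
                                (maximal A B′ (A⊆f⁻¹1 , (λ x → B⊆f⁻¹0 x ∘ B′⊆B x) , 0<|A| , 0<|B′|)))
          b (proj₁ (proj₂ (edge-elim A B a b ab∈E))))

  quarter-ratio≤minEntropyValue : ½ * ½ * ratio A B ≤ minEntropyValue uniformDist
  quarter-ratio≤minEntropyValue = ≤-safeDiv (0<* (0<maxCondA uniformDist) (0<maxCondB uniformDist)) (begin
    ½ * ½ * ratio A B * (maxCondA uniformDist * maxCondB uniformDist)
      ≤⟨ *-monoʳ-≤-0≤ (½ * ½ * ratio A B) 0≤¼R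
           (*-mono-≤-0≤ 0≤qA (ℚ.<⇒≤ (0<maxCondB uniformDist)) maxCondA≤ maxCondB≤) ⟩
    ½ * ½ * ratio A B * (qA * qB)
      ≡⟨ cong₂ (λ x y → ½ * ½ * ratio A B * (x * ε * (y * ε))) (fromℕℚ-* 2 (count A)) (fromℕℚ-* 2 (count B)) ⟩
    ½ * ½ * ratio A B * (fromℕℚ 2 * fromℕℚ (count A) * ε * (fromℕℚ 2 * fromℕℚ (count B) * ε))
      ≡⟨ quarter-identity {ratio A B} {fromℕℚ (count A)} {fromℕℚ (count B)} {fromℕℚ (edges A B)} {ε}
           (ratio-*-counts {A = A} {B} (ℕ.*-mono-≤ 0<|A| 0<|B|)) e*ε≡1 ⟩
    1ℚ ∎)
    where
    open ℚ.≤-Reasoning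
    qA = fromℕℚ (2 ℕ.* count A) * ε
    qB = fromℕℚ (2 ℕ.* count B) * ε
    0≤qA = 0≤* (fromℕℚ-nonneg (2 ℕ.* count A)) 0≤ε
    0≤¼R = 0≤* (ℚ.<⇒≤ (ℚ.positive⁻¹ (½ * ½))) (ℚ.<⇒≤ (ratio-pos {A = A} {B} edges-pos 0<|A| 0<|B|))

proposition6p4 : (n : ℕ) (f : Vec Bool n → Bool) (k : ℚ) →
    IsKhrapchenkoBound f k →
    (Σ (KhrapchenkoDist f) λ D → (½ * ½) * k ≤ minEntropyValue D) ×
    ((D : KhrapchenkoDist f) → minEntropyValue D ≤ k)
proposition6p4 n f k ((A , B , adm , ratio≡k) , maximal) = lower , upper
  where
  maximal′ : ∀ A′ B′ → Admissible f A′ B′ → ratio A′ B′ ≤ ratio A B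
  maximal′ A′ B′ adm′ = subst (ratio A′ B′ ≤_) (sym ratio≡k) (maximal A′ B′ adm′)

  lower : Σ (KhrapchenkoDist f) λ D → ½ * ½ * k ≤ minEntropyValue D
  lower = uniformDist adm maximal′
        , subst (λ r → ½ * ½ * r ≤ minEntropyValue (uniformDist adm maximal′)) ratio≡k
                (quarter-ratio≤minEntropyValue adm maximal′)

  upper : (D : KhrapchenkoDist f) → minEntropyValue D ≤ k
  upper D = let A′ , B′ , adm′ , D≤ratio = minEntropyValue≤ratio D
            in ℚ.≤-trans D≤ratio (maximal A′ B′ adm′)
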